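{- (i) Let $r\in\mathbb{N}$ and $1\le k\le 2r$. Then $$D_r(k):=\sum_{\ell=\lfloor(k-1)/2\rfloor}^{r-1}4(-1)^{\ell+k}\binom{r-1}{\ell}\binom{2\ell+1}{k-1}=\binom{r}{k-r}\frac{2k}{r}(-1)^{k+r-1}2^{2r-k}.$$ In particular $D_r(k)=0$ for $1\le k\le r-1$. (ii) For $1\le p\le 2r$, $$\sum_{k=p}^{2r}\binom{k-1}{k-p}D_r(k)=\begin{cases}0,&p\text{ odd},\\[2pt] 4\binom{r-1}{p/2-1}(-1)^{p/2-1},&p\text{ even}.\end{cases}$$
   Context: Binomial coefficients $\binom{a}{b}$ are taken to be $0$ when $b<0$ or $b>a$. -}

module Defs where

open import Data.Nat as ℕ using (ℕ; zero; suc; _∸_)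
open import Data.Nat.Combinatorics using (_C_)
open import Data.Integer as ℤ using (ℤ; +_; -[1+_]; -1ℤ)
open import Data.List using (List; map; upTo; foldr)

-- Binomial coefficient with integer lower index: (a choose b) = 0 if b < 0 or b > a.
-- (stdlib's  a C b  is already 0 for b > a.)
choose : ℕ → ℤ → ℤ
choose a (+ b)      = + (a C b)
choose a -[1+ _ ]   = + 0

sgn : ℕ → ℤ
sgn n = -1ℤ ℤ.^ n

-- Σ_{i=a}^{b} f i  (empty, i.e. 0, when a > b).
sumFromTo : ℕ → ℕ → (ℕ → ℤ) → ℤ
sumFromTo a b f = foldr ℤ._+_ (+ 0) (map (λ i → f (a ℕ.+ i)) (upTo (suc b ∸ a)))

D : ℕ → ℕ → ℤ
D r k = sumFromTo ((k ∸ 1) ℕ./ 2) (r ∸ 1)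
          (λ ℓ → + 4 ℤ.* sgn (ℓ ℕ.+ k) ℤ.* + ((r ∸ 1) C ℓ) ℤ.* + ((2 ℕ.* ℓ ℕ.+ 1) C (k ∸ 1)))

module Submission where

-- Write r = n+1, k = j+1, p = q+1, and read an integer sequence a : ℕ → ℤ
-- as the coefficient list of a polynomial in x.  The summand of D is
-- -4 C(n,ℓ) times the j-th coefficient of (-1)^ℓ (1-x)^(2ℓ+1), hence
--   D (n+1) (j+1) = -4 [x^j] F_n,  F_n = Σ_ℓ C(n,ℓ) (-1)^ℓ (1-x)^(2ℓ+1)
--                                      = (1-x) (2x - x²)^n.  Part (i) then follows from
-- Pascal's rule and the absorption identity.  For part (ii) the sum over k
-- is -4 [y^q] F_n(1+y).  Substituting x = 1+y turns x into 1+y, so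
-- 2x - x² into 1 - y²; thus S_n(y) = F_n(1+y) satisfies S_{n+1} = (1-y²) S_n
-- with S_0 = -y, i.e. S_n = -y (1-y²)^n, whose coefficients are read off
-- by induction on n.

open import Defs
open import Data.Nat as ℕ using (ℕ; zero; suc; _∸_; _≤_; _<_; z≤n; s≤s; NonZero)
open import Data.Nat.Combinatorics using (_C_; nCk+nC[k+1]≡[n+1]C[k+1]; nCk≡nC[n∸k]; nC1≡n; k>n⇒nCk≡0)
open import Data.Integer as ℤ using (ℤ; +_; -[1+_]; -1ℤ; _+_; _*_; -_; _-_)
open import Data.Rational as ℚ using (_/_)
open import Data.Rational.Properties using (fromℚᵘ-cong)
open import Data.Rational.Unnormalised.Base using (mkℚᵘ; *≡*)
open import Data.List using (foldr; applyUpTo)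
open import Data.List.Properties using (map-applyUpTo)
open import Data.Product using (_×_; _,_)
open import Relation.Binary.PropositionalEquality
open import Relation.Nullary using (yes; no)
open import Data.Integer.Tactic.RingSolver using (solve-∀)
import Data.Integer.Properties as ℤP
import Data.Nat.Properties as ℕP
import Data.Nat.DivMod as ℕDM
import Data.Nat.Tactic.RingSolver as ℕSolver

open ≡-Reasoning

Σ : ℕ → (ℕ → ℤ) → ℤ
Σ zero    f = + 0
Σ (suc N) f = f 0 + Σ N (λ i → f (suc i))

sumFromTo≡Σ : ∀ a b f → sumFromTo a b f ≡ Σ (suc b ∸ a) (λ i → f (a ℕ.+ i))
sumFromTo≡Σ a b f =
  trans (cong (foldr _+_ (+ 0)) (map-applyUpTo (λ i → i) g (suc b ∸ a))) (foldr≡Σ (suc b ∸ a) g)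
  where
    g : ℕ → ℤ
    g i = f (a ℕ.+ i)
    foldr≡Σ : ∀ N (h : ℕ → ℤ) → foldr _+_ (+ 0) (applyUpTo h N) ≡ Σ N h
    foldr≡Σ zero    h = refl
    foldr≡Σ (suc N) h = cong (_+_ (h 0)) (foldr≡Σ N (λ i → h (suc i)))

Σ-cong : ∀ N {f g : ℕ → ℤ} → (∀ i → i < N → f i ≡ g i) → Σ N f ≡ Σ N g
Σ-cong zero    eq = refl
Σ-cong (suc N) eq = cong₂ _+_ (eq 0 (s≤s z≤n)) (Σ-cong N (λ i i<N → eq (suc i) (s≤s i<N)))

Σ-zero : ∀ N (f : ℕ → ℤ) → (∀ i → i < N → f i ≡ + 0) → Σ N f ≡ + 0
Σ-zero N f eq = trans (Σ-cong N eq) (Σ-of-zeros N)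
  where
    Σ-of-zeros : ∀ N → Σ N (λ _ → + 0) ≡ + 0
    Σ-of-zeros zero    = refl
    Σ-of-zeros (suc N) = trans (ℤP.+-identityˡ _) (Σ-of-zeros N)

Σ-+ : ∀ N (f g : ℕ → ℤ) → Σ N (λ i → f i + g i) ≡ Σ N f + Σ N g
Σ-+ zero    f g = refl
Σ-+ (suc N) f g = trans (cong (_+_ (f 0 + g 0)) (Σ-+ N _ _)) (interchange (f 0) (g 0) _ _)
  where
    interchange : ∀ a b c d → (a + b) + (c + d) ≡ (a + c) + (b + d)
    interchange = solve-∀

Σ-neg : ∀ N (f : ℕ → ℤ) → Σ N (λ i → - f i) ≡ - Σ N f
Σ-neg zero    f = refl
Σ-neg (suc N) f = trans (cong (_+_ (- f 0)) (Σ-neg N _)) (sym (ℤP.neg-distrib-+ (f 0) _))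

Σ-− : ∀ N (f g : ℕ → ℤ) → Σ N (λ i → f i - g i) ≡ Σ N f - Σ N g
Σ-− N f g = trans (Σ-+ N f (λ i → - g i)) (cong (_+_ (Σ N f)) (Σ-neg N g))

Σ-scale : ∀ N c (f : ℕ → ℤ) → Σ N (λ i → c * f i) ≡ c * Σ N f
Σ-scale zero    c f = sym (ℤP.*-zeroʳ c)
Σ-scale (suc N) c f = trans (cong (_+_ (c * f 0)) (Σ-scale N c _)) (sym (ℤP.*-distribˡ-+ c (f 0) _))

Σ-drop-last : ∀ N (f : ℕ → ℤ) → f N ≡ + 0 → Σ (suc N) f ≡ Σ N f
Σ-drop-last zero    f f0≡0 = cong (_+ + 0) f0≡0
Σ-drop-last (suc N) f fN≡0 = cong (_+_ (f 0)) (Σ-drop-last N (λ i → f (suc i)) fN≡0)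

Σ-skip : ∀ a N (f : ℕ → ℤ) → (∀ i → i < a → f i ≡ + 0) →
         Σ (N ∸ a) (λ i → f (a ℕ.+ i)) ≡ Σ N f
Σ-skip zero    N       f vanish = refl
Σ-skip (suc a) zero    f vanish = refl
Σ-skip (suc a) (suc N) f vanish = begin
  Σ (N ∸ a) (λ i → f (suc a ℕ.+ i))   ≡⟨ Σ-skip a N (λ i → f (suc i)) (λ i i<a → vanish (suc i) (s≤s i<a)) ⟩
  Σ N (λ i → f (suc i))               ≡⟨ ℤP.+-identityˡ _ ⟨
  + 0 + Σ N (λ i → f (suc i))         ≡⟨ cong (_+ Σ N (λ i → f (suc i))) (vanish 0 (s≤s z≤n)) ⟨
  Σ (suc N) f                         ∎

sumFromTo-extend : ∀ a b (f g : ℕ → ℤ) → (∀ i → f (a ℕ.+ i) ≡ g (a ℕ.+ i)) →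
                   (∀ i → i < a → g i ≡ + 0) → sumFromTo a b f ≡ Σ (suc b) g
sumFromTo-extend a b f g agree vanish = begin
  sumFromTo a b f                        ≡⟨ sumFromTo≡Σ a b f ⟩
  Σ (suc b ∸ a) (λ i → f (a ℕ.+ i))      ≡⟨ Σ-cong (suc b ∸ a) (λ i _ → agree i) ⟩
  Σ (suc b ∸ a) (λ i → g (a ℕ.+ i))      ≡⟨ Σ-skip a (suc b) g vanish ⟩
  Σ (suc b) g                            ∎

-- shift a is the coefficient sequence of x·a.
shift : (ℕ → ℤ) → ℕ → ℤ
shift a zero    = + 0
shift a (suc j) = a j

shift-cong : ∀ {a b : ℕ → ℤ} → (∀ i → a i ≡ b i) → ∀ j → shift a j ≡ shift b j
shift-cong eq zero    = refl
shift-cong eq (suc j) = eq j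

shift-pointwise : ∀ (op : ℤ → ℤ → ℤ) → op (+ 0) (+ 0) ≡ + 0 →
                  ∀ (a b : ℕ → ℤ) j → shift (λ i → op (a i) (b i)) j ≡ op (shift a j) (shift b j)
shift-pointwise op op00 a b zero    = sym op00
shift-pointwise op op00 a b (suc j) = refl

shift-below : ∀ n (a : ℕ → ℤ) → (∀ i → i < n → a i ≡ + 0) → ∀ j → j ≤ n → shift a j ≡ + 0
shift-below n a vanish zero    _   = refl
shift-below n a vanish (suc j) j<n = vanish j j<n

Σ-shift : ∀ N (b : ℕ → ℕ → ℤ) (c : ℕ → ℤ) j →
          Σ N (λ i → shift (b i) j * c i) ≡ shift (λ j′ → Σ N (λ i → b i j′ * c i)) j
Σ-shift N b c zero    = Σ-zero N _ (λ _ _ → refl)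
Σ-shift N b c (suc j) = refl

sgn-suc : ∀ m → sgn (suc m) ≡ - sgn m
sgn-suc m = ℤP.-1*i≡-i (sgn m)

sgn-+ : ∀ a b → sgn (a ℕ.+ b) ≡ sgn a * sgn b
sgn-+ zero    b = sym (ℤP.*-identityˡ (sgn b))
sgn-+ (suc a) b = trans (cong (-1ℤ *_) (sgn-+ a b)) (sym (ℤP.*-assoc -1ℤ (sgn a) (sgn b)))

sgn-square : ∀ a → sgn a * sgn a ≡ + 1
sgn-square zero    = refl
sgn-square (suc a) = trans (square-neg (sgn a)) (sgn-square a)
  where
    square-neg : ∀ x → (-1ℤ * x) * (-1ℤ * x) ≡ x * x
    square-neg = solve-∀

sgn-odd-offset : ∀ n t → sgn ((n ℕ.+ t) ℕ.+ suc n) ≡ - sgn t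
sgn-odd-offset n t = begin
  sgn ((n ℕ.+ t) ℕ.+ suc n)      ≡⟨ sgn-+ (n ℕ.+ t) (suc n) ⟩
  sgn (n ℕ.+ t) * sgn (suc n)    ≡⟨ cong (_* sgn (suc n)) (sgn-+ n t) ⟩
  (sgn n * sgn t) * (-1ℤ * sgn n) ≡⟨ regroup (sgn n) (sgn t) ⟩
  - (sgn n * sgn n * sgn t)      ≡⟨ cong (λ x → - (x * sgn t)) (sgn-square n) ⟩
  - (+ 1 * sgn t)                ≡⟨ cong -_ (ℤP.*-identityˡ (sgn t)) ⟩
  - sgn t                        ∎
  where
    regroup : ∀ a s → (a * s) * (-1ℤ * a) ≡ - (a * a * s)
    regroup = solve-∀

sgn-shift : ∀ s (a : ℕ → ℤ) j →
            sgn (s ℕ.+ j) * shift a j ≡ - shift (λ i → sgn (s ℕ.+ i) * a i) j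
sgn-shift s a zero    = ℤP.*-zeroʳ (sgn (s ℕ.+ 0))
sgn-shift s a (suc j) = begin
  sgn (s ℕ.+ suc j) * a j   ≡⟨ cong (λ e → sgn e * a j) (ℕP.+-suc s j) ⟩
  sgn (suc (s ℕ.+ j)) * a j ≡⟨ cong (_* a j) (sgn-suc (s ℕ.+ j)) ⟩
  - sgn (s ℕ.+ j) * a j     ≡⟨ ℤP.neg-distribˡ-* (sgn (s ℕ.+ j)) (a j) ⟨
  - (sgn (s ℕ.+ j) * a j)   ∎

sgn-shift² : ∀ s (a : ℕ → ℤ) j →
             sgn (s ℕ.+ j) * shift (shift a) j ≡ shift (shift (λ i → sgn (s ℕ.+ i) * a i)) j
sgn-shift² s a j = begin
  sgn (s ℕ.+ j) * shift (shift a) j                     ≡⟨ sgn-shift s (shift a) j ⟩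
  - shift (λ i → sgn (s ℕ.+ i) * shift a i) j           ≡⟨ cong -_ (shift-cong (sgn-shift s a) j) ⟩
  - shift (λ i → - shift a′ i) j                        ≡⟨ cong -_ (shift-pointwise (λ x _ → - x) refl (shift a′) a′ j) ⟩
  - - shift (shift a′) j                                ≡⟨ ℤP.neg-involutive _ ⟩
  shift (shift a′) j                                    ∎
  where
    a′ : ℕ → ℤ
    a′ i = sgn (s ℕ.+ i) * a i

-- row n is the coefficient sequence of (1+x)^n.
row : ℕ → ℕ → ℤ
row n k = + (n C k)

row-vanish : ∀ {n k} → n < k → row n k ≡ + 0
row-vanish n<k = cong +_ (k>n⇒nCk≡0 n<k)

row-pascal : ∀ n j → row (suc n) j ≡ row n j + shift (row n) j
row-pascal n zero    = refl
row-pascal n (suc j) = begin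
  + (suc n C suc j)             ≡⟨ cong +_ (nCk+nC[k+1]≡[n+1]C[k+1] n j) ⟨
  + (n C j ℕ.+ n C suc j)       ≡⟨ ℤP.pos-+ (n C j) (n C suc j) ⟩
  + (n C j) + + (n C suc j)     ≡⟨ ℤP.+-comm (+ (n C j)) (+ (n C suc j)) ⟩
  + (n C suc j) + + (n C j)     ∎

row-pascal² : ∀ n j → row (suc (suc n)) j ≡ row n j + + 2 * shift (row n) j + shift (shift (row n)) j
row-pascal² n j = begin
  row (suc (suc n)) j                                     ≡⟨ row-pascal (suc n) j ⟩
  row (suc n) j + shift (row (suc n)) j                   ≡⟨ cong₂ _+_ (row-pascal n j) shifted ⟩
  (row n j + shift (row n) j) + (shift (row n) j + shift (shift (row n)) j)
                                                          ≡⟨ collect (row n j) (shift (row n) j) (shift (shift (row n)) j) ⟩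
  row n j + + 2 * shift (row n) j + shift (shift (row n)) j ∎
  where
    shifted : shift (row (suc n)) j ≡ shift (row n) j + shift (shift (row n)) j
    shifted = trans (shift-cong (row-pascal n) j) (shift-pointwise _+_ refl (row n) (shift (row n)) j)
    collect : ∀ a b c → (a + b) + (b + c) ≡ a + + 2 * b + c
    collect = solve-∀

absorption : ∀ n t → suc t ℕ.* (suc n C suc t) ≡ suc n ℕ.* (n C t)
absorption zero    zero    = refl
absorption zero    (suc t) = ℕP.*-zeroʳ (suc (suc t))
absorption (suc n) zero    = trans (ℕP.*-identityˡ _) (trans (nC1≡n (suc (suc n))) (sym (ℕP.*-identityʳ _)))
absorption (suc n) (suc t) = begin
  suc (suc t) ℕ.* (suc (suc n) C suc (suc t))        ≡⟨ cong (suc (suc t) ℕ.*_) (nCk+nC[k+1]≡[n+1]C[k+1] (suc n) (suc t)) ⟨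
  suc (suc t) ℕ.* (c ℕ.+ suc n C suc (suc t))        ≡⟨ expand t c (suc n C suc (suc t)) ⟩
  c ℕ.+ suc t ℕ.* c ℕ.+ suc (suc t) ℕ.* (suc n C suc (suc t))
                                                     ≡⟨ cong₂ (λ x y → c ℕ.+ x ℕ.+ y) (absorption n t) (absorption n (suc t)) ⟩
  c ℕ.+ suc n ℕ.* (n C t) ℕ.+ suc n ℕ.* (n C suc t)  ≡⟨ factor n c (n C t) (n C suc t) ⟩
  c ℕ.+ suc n ℕ.* (n C t ℕ.+ n C suc t)              ≡⟨ cong (λ x → c ℕ.+ suc n ℕ.* x) (nCk+nC[k+1]≡[n+1]C[k+1] n t) ⟩
  c ℕ.+ suc n ℕ.* c                                  ∎
  where
    c : ℕ
    c = suc n C suc t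
    expand : ∀ t c d → suc (suc t) ℕ.* (c ℕ.+ d) ≡ c ℕ.+ suc t ℕ.* c ℕ.+ suc (suc t) ℕ.* d
    expand = ℕSolver.solve-∀
    factor : ∀ n c a b → c ℕ.+ suc n ℕ.* a ℕ.+ suc n ℕ.* b ≡ c ℕ.+ suc n ℕ.* (a ℕ.+ b)
    factor = ℕSolver.solve-∀

absorption-ℤ : ∀ n t → + suc t * row (suc n) (suc t) ≡ + suc n * row n t
absorption-ℤ n t = begin
  + suc t * row (suc n) (suc t)        ≡⟨ ℤP.pos-* (suc t) (suc n C suc t) ⟨
  + (suc t ℕ.* (suc n C suc t))        ≡⟨ cong +_ (absorption n t) ⟩
  + (suc n ℕ.* (n C t))                ≡⟨ ℤP.pos-* (suc n) (n C t) ⟩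
  + suc n * row n t                    ∎

-- C(n,t+1) 2^(n-t) = 2 C(n,t+1) 2^(n-t-1), also at t ≥ n where both sides vanish;
-- this absorbs the truncation of ∸ in the exponent.
row-power-step : ∀ n t → row n (suc t) * + (2 ℕ.^ (n ∸ t)) ≡ + 2 * (row n (suc t) * + (2 ℕ.^ (n ∸ suc t)))
row-power-step n t with t ℕ.<? n
... | yes t<n = begin
  row n (suc t) * + (2 ℕ.^ (n ∸ t))             ≡⟨ cong (λ e → row n (suc t) * + (2 ℕ.^ e)) (ℕP.+-∸-assoc 1 t<n) ⟩
  row n (suc t) * + (2 ℕ.* 2 ℕ.^ (n ∸ suc t))   ≡⟨ cong (row n (suc t) *_) (ℤP.pos-* 2 (2 ℕ.^ (n ∸ suc t))) ⟩
  row n (suc t) * (+ 2 * + (2 ℕ.^ (n ∸ suc t))) ≡⟨ swap (row n (suc t)) _ ⟩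
  + 2 * (row n (suc t) * + (2 ℕ.^ (n ∸ suc t))) ∎
  where
    swap : ∀ b q → b * (+ 2 * q) ≡ + 2 * (b * q)
    swap = solve-∀
... | no t≮n = begin
  row n (suc t) * + (2 ℕ.^ (n ∸ t))             ≡⟨ cong (_* + (2 ℕ.^ (n ∸ t))) b≡0 ⟩
  + 0 * + (2 ℕ.^ (n ∸ t))                       ≡⟨ ℤP.*-zeroˡ (+ (2 ℕ.^ (n ∸ t))) ⟩
  + 0                                           ≡⟨ ℤP.*-zeroˡ (+ (2 ℕ.^ (n ∸ suc t))) ⟨
  + 0 * + (2 ℕ.^ (n ∸ suc t))                   ≡⟨ ℤP.*-zeroʳ (+ 2) ⟨
  + 2 * (+ 0 * + (2 ℕ.^ (n ∸ suc t)))           ≡⟨ cong (λ b → + 2 * (b * + (2 ℕ.^ (n ∸ suc t)))) b≡0 ⟨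
  + 2 * (row n (suc t) * + (2 ℕ.^ (n ∸ suc t))) ∎
  where
    b≡0 : row n (suc t) ≡ + 0
    b≡0 = row-vanish (s≤s (ℕP.≮⇒≥ t≮n))

-- oddPow ℓ is the coefficient sequence of (-1)^ℓ (1-x)^(2ℓ+1).
oddPow : ℕ → ℕ → ℤ
oddPow ℓ j = sgn (ℓ ℕ.+ j) * row (2 ℕ.* ℓ ℕ.+ 1) j

oddPow-vanish : ∀ ℓ j → 2 ℕ.* ℓ ℕ.+ 1 < j → oddPow ℓ j ≡ + 0
oddPow-vanish ℓ j lt = trans (cong (sgn (ℓ ℕ.+ j) *_) (row-vanish lt)) (ℤP.*-zeroʳ (sgn (ℓ ℕ.+ j)))

-- (-1)^(ℓ+1) (1-x)^(2ℓ+3) = -(1 - 2x + x²) (-1)^ℓ (1-x)^(2ℓ+1).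
oddPow-step : ∀ ℓ j → oddPow (suc ℓ) j ≡ + 2 * shift (oddPow ℓ) j - shift (shift (oddPow ℓ)) j - oddPow ℓ j
oddPow-step ℓ j = begin
  sgn (suc ℓ ℕ.+ j) * row (2 ℕ.* suc ℓ ℕ.+ 1) j
    ≡⟨ cong₂ _*_ (sgn-suc (ℓ ℕ.+ j)) (trans (cong (λ m → row m j) (odd-suc ℓ)) (row-pascal² (2 ℕ.* ℓ ℕ.+ 1) j)) ⟩
  - s * (b j + + 2 * shift b j + shift (shift b) j)
    ≡⟨ distribute s (b j) (shift b j) (shift (shift b) j) ⟩
  + 2 * - (s * shift b j) - s * shift (shift b) j - s * b j
    ≡⟨ cong₂ (λ x y → + 2 * x - y - s * b j) (trans (cong -_ (sgn-shift ℓ b j)) (ℤP.neg-involutive _)) (sgn-shift² ℓ b j) ⟩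
  + 2 * shift (oddPow ℓ) j - shift (shift (oddPow ℓ)) j - oddPow ℓ j ∎
  where
    s : ℤ
    s = sgn (ℓ ℕ.+ j)
    b : ℕ → ℤ
    b = row (2 ℕ.* ℓ ℕ.+ 1)
    odd-suc : ∀ ℓ → 2 ℕ.* suc ℓ ℕ.+ 1 ≡ suc (suc (2 ℕ.* ℓ ℕ.+ 1))
    odd-suc = ℕSolver.solve-∀
    distribute : ∀ s a c d → - s * (a + + 2 * c + d) ≡ + 2 * - (s * c) - s * d - s * a
    distribute = solve-∀

F : ℕ → ℕ → ℤ
F n j = Σ (suc n) (λ ℓ → oddPow ℓ j * row n ℓ)

-4ℤ : ℤ
-4ℤ = - + 4

-- Only ℓ ≥ ⌊j/2⌋ contribute to F n j, so the sum defining D covers all of F.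
D≡-4F : ∀ n j → D (suc n) (suc j) ≡ -4ℤ * F n j
D≡-4F n j = begin
  D (suc n) (suc j)                          ≡⟨ sumFromTo-extend (j ℕ./ 2) n termD g (λ i → summand (j ℕ./ 2 ℕ.+ i)) vanish ⟩
  Σ (suc n) g                                ≡⟨ Σ-scale (suc n) -4ℤ (λ ℓ → oddPow ℓ j * row n ℓ) ⟩
  -4ℤ * F n j                                ∎
  where
    termD g : ℕ → ℤ
    termD ℓ = + 4 * sgn (ℓ ℕ.+ suc j) * row n ℓ * row (2 ℕ.* ℓ ℕ.+ 1) j
    g ℓ = -4ℤ * (oddPow ℓ j * row n ℓ)
    summand : ∀ ℓ → termD ℓ ≡ g ℓ
    summand ℓ = begin
      + 4 * sgn (ℓ ℕ.+ suc j) * row n ℓ * row (2 ℕ.* ℓ ℕ.+ 1) j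
        ≡⟨ cong (λ e → + 4 * sgn e * row n ℓ * row (2 ℕ.* ℓ ℕ.+ 1) j) (ℕP.+-suc ℓ j) ⟩
      + 4 * sgn (suc (ℓ ℕ.+ j)) * row n ℓ * row (2 ℕ.* ℓ ℕ.+ 1) j
        ≡⟨ cong (λ x → + 4 * x * row n ℓ * row (2 ℕ.* ℓ ℕ.+ 1) j) (sgn-suc (ℓ ℕ.+ j)) ⟩
      + 4 * - sgn (ℓ ℕ.+ j) * row n ℓ * row (2 ℕ.* ℓ ℕ.+ 1) j
        ≡⟨ regroup (sgn (ℓ ℕ.+ j)) (row n ℓ) (row (2 ℕ.* ℓ ℕ.+ 1) j) ⟩
      g ℓ ∎
      where
        regroup : ∀ s a b → + 4 * - s * a * b ≡ - + 4 * (s * b * a)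
        regroup = solve-∀
    -- Below ℓ = ⌊j/2⌋ the degree 2ℓ+1 is smaller than j.
    vanish : ∀ ℓ → ℓ < j ℕ./ 2 → g ℓ ≡ + 0
    vanish ℓ ℓ<j/2 = cong (λ x → -4ℤ * (x * row n ℓ)) (oddPow-vanish ℓ j odd<j)
      where
        odd<j : 2 ℕ.* ℓ ℕ.+ 1 < j
        odd<j = ℕP.≤-trans (ℕP.≤-reflexive (twice ℓ)) (ℕP.≤-trans (ℕP.*-monoˡ-≤ 2 ℓ<j/2) (ℕDM.m/n*n≤m j 2))
          where
            twice : ∀ ℓ → suc (2 ℕ.* ℓ ℕ.+ 1) ≡ suc ℓ ℕ.* 2
            twice = ℕSolver.solve-∀

-- Multiplication by Q(x) = 2x - x².
mulQ : (ℕ → ℤ) → ℕ → ℤ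
mulQ a j = + 2 * shift a j - shift (shift a) j

mulQ-cong : ∀ {a b : ℕ → ℤ} → (∀ i → a i ≡ b i) → ∀ j → mulQ a j ≡ mulQ b j
mulQ-cong eq j = cong₂ (λ x y → + 2 * x - y) (shift-cong eq j) (shift-cong (shift-cong eq) j)

binomial-sum-step : ∀ n (g : ℕ → ℤ) →
  Σ (suc (suc n)) (λ ℓ → g ℓ * row (suc n) ℓ)
    ≡ Σ (suc n) (λ ℓ → g ℓ * row n ℓ) + Σ (suc n) (λ ℓ → g (suc ℓ) * row n ℓ)
binomial-sum-step n g = begin
  Σ (suc (suc n)) (λ ℓ → g ℓ * row (suc n) ℓ)
    ≡⟨ Σ-cong (suc (suc n)) (λ ℓ _ → pascal-split ℓ) ⟩
  Σ (suc (suc n)) (λ ℓ → g ℓ * row n ℓ + g ℓ * shift (row n) ℓ)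
    ≡⟨ Σ-+ (suc (suc n)) (λ ℓ → g ℓ * row n ℓ) (λ ℓ → g ℓ * shift (row n) ℓ) ⟩
  Σ (suc (suc n)) (λ ℓ → g ℓ * row n ℓ) + Σ (suc (suc n)) (λ ℓ → g ℓ * shift (row n) ℓ)
    ≡⟨ cong₂ _+_ drop-last drop-first ⟩
  Σ (suc n) (λ ℓ → g ℓ * row n ℓ) + Σ (suc n) (λ ℓ → g (suc ℓ) * row n ℓ) ∎
  where
    pascal-split : ∀ ℓ → g ℓ * row (suc n) ℓ ≡ g ℓ * row n ℓ + g ℓ * shift (row n) ℓ
    pascal-split ℓ = trans (cong (g ℓ *_) (row-pascal n ℓ)) (ℤP.*-distribˡ-+ (g ℓ) (row n ℓ) (shift (row n) ℓ))
    drop-last : Σ (suc (suc n)) (λ ℓ → g ℓ * row n ℓ) ≡ Σ (suc n) (λ ℓ → g ℓ * row n ℓ)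
    drop-last = Σ-drop-last (suc n) (λ ℓ → g ℓ * row n ℓ)
                  (trans (cong (g (suc n) *_) (row-vanish (ℕP.n<1+n n))) (ℤP.*-zeroʳ (g (suc n))))
    drop-first : Σ (suc (suc n)) (λ ℓ → g ℓ * shift (row n) ℓ) ≡ Σ (suc n) (λ ℓ → g (suc ℓ) * row n ℓ)
    drop-first = trans (cong (_+ Σ (suc n) (λ ℓ → g (suc ℓ) * row n ℓ)) (ℤP.*-zeroʳ (g 0))) (ℤP.+-identityˡ _)

F-step : ∀ n j → F (suc n) j ≡ mulQ (F n) j
F-step n j = begin
  F (suc n) j
    ≡⟨ binomial-sum-step n (λ ℓ → oddPow ℓ j) ⟩
  F n j + Σ (suc n) (λ ℓ → oddPow (suc ℓ) j * row n ℓ)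
    ≡⟨ cong (_+_ (F n j)) (Σ-cong (suc n) (λ ℓ _ → step-summand ℓ)) ⟩
  F n j + Σ (suc n) (λ ℓ → + 2 * (sh ℓ * row n ℓ) - sh² ℓ * row n ℓ - oddPow ℓ j * row n ℓ)
    ≡⟨ cong (_+_ (F n j)) linearity ⟩
  F n j + (+ 2 * Σ (suc n) (λ ℓ → sh ℓ * row n ℓ) - Σ (suc n) (λ ℓ → sh² ℓ * row n ℓ) - F n j)
    ≡⟨ cong₂ (λ x y → F n j + (+ 2 * x - y - F n j)) (Σ-shift (suc n) oddPow (row n) j) shifted² ⟩
  F n j + (+ 2 * shift (F n) j - shift (shift (F n)) j - F n j)
    ≡⟨ cancel (F n j) (shift (F n) j) (shift (shift (F n)) j) ⟩
  mulQ (F n) j ∎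
  where
    sh sh² : ℕ → ℤ
    sh ℓ = shift (oddPow ℓ) j
    sh² ℓ = shift (shift (oddPow ℓ)) j
    spread : ∀ a b c r → (+ 2 * a - b - c) * r ≡ + 2 * (a * r) - b * r - c * r
    spread = solve-∀
    step-summand : ∀ ℓ → oddPow (suc ℓ) j * row n ℓ
                 ≡ + 2 * (sh ℓ * row n ℓ) - sh² ℓ * row n ℓ - oddPow ℓ j * row n ℓ
    step-summand ℓ = trans (cong (_* row n ℓ) (oddPow-step ℓ j)) (spread (sh ℓ) (sh² ℓ) (oddPow ℓ j) (row n ℓ))
    linearity : Σ (suc n) (λ ℓ → + 2 * (sh ℓ * row n ℓ) - sh² ℓ * row n ℓ - oddPow ℓ j * row n ℓ)
              ≡ + 2 * Σ (suc n) (λ ℓ → sh ℓ * row n ℓ) - Σ (suc n) (λ ℓ → sh² ℓ * row n ℓ) - F n j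
    linearity = begin
      Σ (suc n) (λ ℓ → + 2 * (sh ℓ * row n ℓ) - sh² ℓ * row n ℓ - oddPow ℓ j * row n ℓ)
        ≡⟨ Σ-− (suc n) (λ ℓ → + 2 * (sh ℓ * row n ℓ) - sh² ℓ * row n ℓ) (λ ℓ → oddPow ℓ j * row n ℓ) ⟩
      Σ (suc n) (λ ℓ → + 2 * (sh ℓ * row n ℓ) - sh² ℓ * row n ℓ) - F n j
        ≡⟨ cong (_- F n j) (Σ-− (suc n) (λ ℓ → + 2 * (sh ℓ * row n ℓ)) (λ ℓ → sh² ℓ * row n ℓ)) ⟩
      Σ (suc n) (λ ℓ → + 2 * (sh ℓ * row n ℓ)) - Σ (suc n) (λ ℓ → sh² ℓ * row n ℓ) - F n j
        ≡⟨ cong (λ x → x - Σ (suc n) (λ ℓ → sh² ℓ * row n ℓ) - F n j) (Σ-scale (suc n) (+ 2) (λ ℓ → sh ℓ * row n ℓ)) ⟩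
      + 2 * Σ (suc n) (λ ℓ → sh ℓ * row n ℓ) - Σ (suc n) (λ ℓ → sh² ℓ * row n ℓ) - F n j ∎
    shifted² : Σ (suc n) (λ ℓ → sh² ℓ * row n ℓ) ≡ shift (shift (F n)) j
    shifted² = trans (Σ-shift (suc n) (λ ℓ → shift (oddPow ℓ)) (row n) j)
                     (shift-cong (Σ-shift (suc n) oddPow (row n)) j)
    cancel : ∀ f a b → f + (+ 2 * a - b - f) ≡ + 2 * a - b
    cancel = solve-∀

E : ℕ → ℕ → ℤ
E zero    zero    = + 1
E zero    (suc j) = + 0
E (suc n) j       = mulQ (E n) j

mul1-x : (ℕ → ℤ) → ℕ → ℤ
mul1-x a j = a j - shift a j

mulQ-mul1-x : ∀ (a : ℕ → ℤ) j → mulQ (mul1-x a) j ≡ mul1-x (mulQ a) j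
mulQ-mul1-x a j = begin
  + 2 * shift (mul1-x a) j - shift (shift (mul1-x a)) j
    ≡⟨ cong₂ (λ x y → + 2 * x - y) (shift-pointwise _-_ refl a (shift a) j) shifted² ⟩
  + 2 * (shift a j - shift (shift a) j) - (shift (shift a) j - shift (shift (shift a)) j)
    ≡⟨ regroup (shift a j) _ _ ⟩
  (+ 2 * shift a j - shift (shift a) j) - (+ 2 * shift (shift a) j - shift (shift (shift a)) j)
    ≡⟨ cong (_-_ (mulQ a j)) (shift-pointwise (λ x y → + 2 * x - y) refl (shift a) (shift (shift a)) j) ⟨
  mul1-x (mulQ a) j ∎
  where
    shifted² : shift (shift (mul1-x a)) j ≡ shift (shift a) j - shift (shift (shift a)) j
    shifted² = trans (shift-cong (shift-pointwise _-_ refl a (shift a)) j)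
                     (shift-pointwise _-_ refl (shift a) (shift (shift a)) j)
    regroup : ∀ a b c → + 2 * (a - b) - (b - c) ≡ (+ 2 * a - b) - (+ 2 * b - c)
    regroup = solve-∀

-- F n = (1 - x) E n: both sides satisfy the same recurrence.
F≡mul1-x-E : ∀ n j → F n j ≡ mul1-x (E n) j
F≡mul1-x-E zero    zero          = refl
F≡mul1-x-E zero    (suc zero)    = refl
F≡mul1-x-E zero    (suc (suc j)) = begin
  sgn (suc (suc j)) * + 0 * + 1 + + 0   ≡⟨ ℤP.+-identityʳ _ ⟩
  sgn (suc (suc j)) * + 0 * + 1         ≡⟨ ℤP.*-identityʳ _ ⟩
  sgn (suc (suc j)) * + 0               ≡⟨ ℤP.*-zeroʳ (sgn (suc (suc j))) ⟩
  + 0                                   ∎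
F≡mul1-x-E (suc n) j = begin
  F (suc n) j               ≡⟨ F-step n j ⟩
  mulQ (F n) j              ≡⟨ mulQ-cong (F≡mul1-x-E n) j ⟩
  mulQ (mul1-x (E n)) j     ≡⟨ mulQ-mul1-x (E n) j ⟩
  mul1-x (E (suc n)) j      ∎

-- E n = x^n (2-x)^n has no coefficients below x^n …
E-below : ∀ n j → j < n → E n j ≡ + 0
E-below (suc n) zero    _         = refl
E-below (suc n) (suc j) (s≤s j<n) =
  cong₂ (λ x y → + 2 * x - y) (E-below n j j<n) (shift-below n (E n) (E-below n) j (ℕP.<⇒≤ j<n))

xE-below : ∀ n j → j ≤ n → shift (E n) j ≡ + 0
xE-below n = shift-below n (E n) (E-below n)

E-diagonal : ∀ n t → E n (n ℕ.+ t) ≡ row n t * + (2 ℕ.^ (n ∸ t)) * sgn t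
E-diagonal zero    zero    = refl
E-diagonal zero    (suc t) = refl
E-diagonal (suc n) zero    = begin
  + 2 * E n (n ℕ.+ 0) - shift (E n) (n ℕ.+ 0)
    ≡⟨ cong₂ (λ x y → + 2 * x - y) (E-diagonal n 0) (xE-below n (n ℕ.+ 0) (ℕP.≤-reflexive (ℕP.+-identityʳ n))) ⟩
  + 2 * (+ 1 * + (2 ℕ.^ n) * + 1) - + 0
    ≡⟨ simplify (+ (2 ℕ.^ n)) ⟩
  + 1 * (+ 2 * + (2 ℕ.^ n)) * + 1
    ≡⟨ cong (λ x → + 1 * x * + 1) (ℤP.pos-* 2 (2 ℕ.^ n)) ⟨
  + 1 * + (2 ℕ.^ suc n) * + 1 ∎
  where
    simplify : ∀ p → + 2 * (+ 1 * p * + 1) - + 0 ≡ + 1 * (+ 2 * p) * + 1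
    simplify = solve-∀
E-diagonal (suc n) (suc t) = begin
  + 2 * E n (n ℕ.+ suc t) - shift (E n) (n ℕ.+ suc t)
    ≡⟨ cong (λ e → + 2 * E n (n ℕ.+ suc t) - shift (E n) e) (ℕP.+-suc n t) ⟩
  + 2 * E n (n ℕ.+ suc t) - E n (n ℕ.+ t)
    ≡⟨ cong₂ (λ x y → + 2 * x - y) (E-diagonal n (suc t)) (E-diagonal n t) ⟩
  + 2 * (b₁ * Q * sgn (suc t)) - b₀ * P * s
    ≡⟨ cong (λ x → + 2 * (b₁ * Q * x) - b₀ * P * s) (sgn-suc t) ⟩
  + 2 * (b₁ * Q * - s) - b₀ * P * s
    ≡⟨ regroup b₀ (b₁ * Q) P s ⟩
  (+ 2 * (b₁ * Q)) * - s + b₀ * P * - s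
    ≡⟨ cong (λ x → x * - s + b₀ * P * - s) (row-power-step n t) ⟨
  b₁ * P * - s + b₀ * P * - s
    ≡⟨ ℤP.*-distribʳ-+ (- s) (b₁ * P) (b₀ * P) ⟨
  (b₁ * P + b₀ * P) * - s
    ≡⟨ cong (_* - s) (ℤP.*-distribʳ-+ P b₁ b₀) ⟨
  (b₁ + b₀) * P * - s
    ≡⟨ cong₂ (λ x y → x * P * y) (row-pascal n (suc t)) (sgn-suc t) ⟨
  row (suc n) (suc t) * P * sgn (suc t) ∎
  where
    b₀ b₁ s P Q : ℤ
    b₀ = row n t
    b₁ = row n (suc t)
    s = sgn t
    P = + (2 ℕ.^ (n ∸ t))
    Q = + (2 ℕ.^ (n ∸ suc t))
    regroup : ∀ b₀ x P s → + 2 * (x * - s) - b₀ * P * s ≡ (+ 2 * x) * - s + b₀ * P * - s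
    regroup = solve-∀

D-via-E : ∀ n j → D (suc n) (suc j) ≡ -4ℤ * mul1-x (E n) j
D-via-E n j = trans (D≡-4F n j) (cong (-4ℤ *_) (F≡mul1-x-E n j))

D-below : ∀ n j → j < n → D (suc n) (suc j) ≡ + 0
D-below n j j<n = trans (D-via-E n j)
  (cong₂ (λ x y → -4ℤ * (x - y)) (E-below n j j<n) (xE-below n j (ℕP.<⇒≤ j<n)))

-- The numerator of the closed form of part (i), r · D_r(k).
closedForm : ℕ → ℕ → ℤ
closedForm r k = choose r (+ k ℤ.- + r) * + (2 ℕ.* k) * sgn (k ℕ.+ r ∸ 1) * + (2 ℕ.^ (2 ℕ.* r ∸ k))

closedForm-above : ∀ n t → closedForm (suc n) (suc (n ℕ.+ t))
                 ≡ row (suc n) t * (+ 2 * (+ suc n + + t)) * - sgn t * + (2 ℕ.^ (suc n ∸ t))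
closedForm-above n t = begin
  choose (suc n) (+ suc (n ℕ.+ t) - + suc n) * + (2 ℕ.* suc (n ℕ.+ t)) * sgn ((n ℕ.+ t) ℕ.+ suc n)
    * + (2 ℕ.^ (2 ℕ.* suc n ∸ suc (n ℕ.+ t)))
    ≡⟨ cong₂ (λ c e → choose (suc n) c * + (2 ℕ.* suc (n ℕ.+ t)) * sgn ((n ℕ.+ t) ℕ.+ suc n) * + (2 ℕ.^ e))
             lower-index exponent ⟩
  row (suc n) t * + (2 ℕ.* suc (n ℕ.+ t)) * sgn ((n ℕ.+ t) ℕ.+ suc n) * + (2 ℕ.^ (suc n ∸ t))
    ≡⟨ cong₂ (λ x y → row (suc n) t * x * y * + (2 ℕ.^ (suc n ∸ t))) twice-k (sgn-odd-offset n t) ⟩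
  row (suc n) t * (+ 2 * (+ suc n + + t)) * - sgn t * + (2 ℕ.^ (suc n ∸ t)) ∎
  where
    lower-index : + suc (n ℕ.+ t) - + suc n ≡ + t
    lower-index = trans (cong (_- + suc n) (ℤP.pos-+ (suc n) t)) (cancel (+ suc n) (+ t))
      where
        cancel : ∀ a b → (a + b) - a ≡ b
        cancel = solve-∀
    exponent : 2 ℕ.* suc n ∸ suc (n ℕ.+ t) ≡ suc n ∸ t
    exponent = trans (ℕP.[m+n]∸[m+o]≡n∸o (suc n) (suc n ℕ.+ 0) t) (cong (_∸ t) (ℕP.+-identityʳ (suc n)))
    twice-k : + (2 ℕ.* suc (n ℕ.+ t)) ≡ + 2 * (+ suc n + + t)
    twice-k = trans (ℤP.pos-* 2 (suc n ℕ.+ t)) (cong (+ 2 *_) (ℤP.pos-+ (suc n) t))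

twice-mul1-x-E : ∀ n t → + 2 * mul1-x (E n) (n ℕ.+ suc t)
               ≡ - (sgn t * + (2 ℕ.^ (n ∸ t)) * (row n (suc t) + + 2 * row n t))
twice-mul1-x-E n t = begin
  + 2 * (E n (n ℕ.+ suc t) - shift (E n) (n ℕ.+ suc t))
    ≡⟨ cong (λ e → + 2 * (E n (n ℕ.+ suc t) - shift (E n) e)) (ℕP.+-suc n t) ⟩
  + 2 * (E n (n ℕ.+ suc t) - E n (n ℕ.+ t))
    ≡⟨ cong₂ (λ x y → + 2 * (x - y)) (E-diagonal n (suc t)) (E-diagonal n t) ⟩
  + 2 * (b₁ * Q * sgn (suc t) - b₀ * P * s)
    ≡⟨ cong (λ x → + 2 * (b₁ * Q * x - b₀ * P * s)) (sgn-suc t) ⟩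
  + 2 * (b₁ * Q * - s - b₀ * P * s)
    ≡⟨ regroup b₀ (b₁ * Q) P s ⟩
  - (s * (+ 2 * (b₁ * Q) + + 2 * b₀ * P))
    ≡⟨ cong (λ x → - (s * (x + + 2 * b₀ * P))) (row-power-step n t) ⟨
  - (s * (b₁ * P + + 2 * b₀ * P))
    ≡⟨ factor b₀ b₁ P s ⟩
  - (s * P * (b₁ + + 2 * b₀)) ∎
  where
    b₀ b₁ s P Q : ℤ
    b₀ = row n t
    b₁ = row n (suc t)
    s = sgn t
    P = + (2 ℕ.^ (n ∸ t))
    Q = + (2 ℕ.^ (n ∸ suc t))
    regroup : ∀ b₀ x P s → + 2 * (x * - s - b₀ * P * s) ≡ - (s * (+ 2 * x + + 2 * b₀ * P))
    regroup = solve-∀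
    factor : ∀ b₀ b₁ P s → - (s * (b₁ * P + + 2 * b₀ * P)) ≡ - (s * P * (b₁ + + 2 * b₀))
    factor = solve-∀

D-above : ∀ n t → D (suc n) (suc (n ℕ.+ t)) * + suc n
        ≡ row (suc n) t * (+ 2 * (+ suc n + + t)) * - sgn t * + (2 ℕ.^ (suc n ∸ t))
D-above n zero = begin
  D (suc n) (suc (n ℕ.+ 0)) * R
    ≡⟨ cong (_* R) (D-via-E n (n ℕ.+ 0)) ⟩
  -4ℤ * (E n (n ℕ.+ 0) - shift (E n) (n ℕ.+ 0)) * R
    ≡⟨ cong₂ (λ x y → -4ℤ * (x - y) * R) (E-diagonal n 0) (xE-below n (n ℕ.+ 0) (ℕP.≤-reflexive (ℕP.+-identityʳ n))) ⟩
  -4ℤ * (+ 1 * + (2 ℕ.^ n) * + 1 - + 0) * R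
    ≡⟨ simplify (+ (2 ℕ.^ n)) R ⟩
  + 1 * (+ 2 * (R + + 0)) * - + 1 * (+ 2 * + (2 ℕ.^ n))
    ≡⟨ cong (+ 1 * (+ 2 * (R + + 0)) * - + 1 *_) (ℤP.pos-* 2 (2 ℕ.^ n)) ⟨
  + 1 * (+ 2 * (R + + 0)) * - + 1 * + (2 ℕ.^ suc n) ∎
  where
    R : ℤ
    R = + suc n
    simplify : ∀ p r → - + 4 * (+ 1 * p * + 1 - + 0) * r ≡ + 1 * (+ 2 * (r + + 0)) * - + 1 * (+ 2 * p)
    simplify = solve-∀
D-above n (suc t) = begin
  D (suc n) (suc (n ℕ.+ suc t)) * R
    ≡⟨ cong (_* R) (D-via-E n (n ℕ.+ suc t)) ⟩
  -4ℤ * f * R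
    ≡⟨ regroup f R ⟩
  - (+ 2 * R) * (+ 2 * f)
    ≡⟨ cong (- (+ 2 * R) *_) (twice-mul1-x-E n t) ⟩
  - (+ 2 * R) * - (s * P * (b₁ + + 2 * b₀))
    ≡⟨ collect b₀ b₁ P s R ⟩
  + 2 * s * P * (R * (b₁ + b₀) + R * b₀)
    ≡⟨ cong (λ x → + 2 * s * P * (R * x + R * b₀)) (row-pascal n (suc t)) ⟨
  + 2 * s * P * (R * c + R * b₀)
    ≡⟨ cong (λ x → + 2 * s * P * (R * c + x)) (absorption-ℤ n t) ⟨
  + 2 * s * P * (R * c + T * c)
    ≡⟨ factor s P R T c ⟩
  c * (+ 2 * (R + T)) * - - s * P
    ≡⟨ cong (λ x → c * (+ 2 * (R + T)) * - x * P) (sgn-suc t) ⟨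
  c * (+ 2 * (R + T)) * - sgn (suc t) * P ∎
  where
    f R T b₀ b₁ c s P : ℤ
    f = mul1-x (E n) (n ℕ.+ suc t)
    R = + suc n
    T = + suc t
    b₀ = row n t
    b₁ = row n (suc t)
    c = row (suc n) (suc t)
    s = sgn t
    P = + (2 ℕ.^ (n ∸ t))
    regroup : ∀ f r → - + 4 * f * r ≡ - (+ 2 * r) * (+ 2 * f)
    regroup = solve-∀
    collect : ∀ b₀ b₁ P s r → - (+ 2 * r) * - (s * P * (b₁ + + 2 * b₀)) ≡ + 2 * s * P * (r * (b₁ + b₀) + r * b₀)
    collect = solve-∀
    factor : ∀ s P r t c → + 2 * s * P * (r * c + t * c) ≡ c * (+ 2 * (r + t)) * - - s * P
    factor = solve-∀

D-closedForm : ∀ n j → D (suc n) (suc j) * + suc n ≡ closedForm (suc n) (suc j)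
D-closedForm n j with j ℕ.<? n
... | no j≮n with ℕP.m≤n⇒∃[o]m+o≡n (ℕP.≮⇒≥ j≮n)
...   | t , refl = trans (D-above n t) (sym (closedForm-above n t))
D-closedForm n j | yes j<n with ℕP.m≤n⇒∃[o]m+o≡n j<n
...   | d , refl = trans (cong (_* + suc n) (D-below n j j<n)) (sym negative-index)
  where
    -- the lower index k - r = -(d+1) is negative, so the binomial coefficient vanishes
    negative-index : closedForm (suc n) (suc j) ≡ + 0
    negative-index =
      cong (λ c → choose (suc n) c * + (2 ℕ.* suc j) * sgn (suc j ℕ.+ suc n ∸ 1)
                    * + (2 ℕ.^ (2 ℕ.* suc n ∸ suc j)))
           lower-index
      where
        cancel : ∀ a b → a - (a + b) ≡ - b
        cancel = solve-∀
        lower-index : + suc j - + suc n ≡ -[1+ d ]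
        lower-index = begin
          + suc j - + suc n                ≡⟨ cong (λ e → + suc j - + e) (ℕP.+-suc (suc j) d) ⟨
          + suc j - + (suc j ℕ.+ suc d)    ≡⟨ cong (_-_ (+ suc j)) (ℤP.pos-+ (suc j) (suc d)) ⟩
          + suc j - (+ suc j + + suc d)    ≡⟨ cancel (+ suc j) (+ suc d) ⟩
          -[1+ d ]                         ∎

fraction-cross : ∀ (a b : ℤ) n → a * + suc n ≡ b → a / 1 ≡ b / suc n
fraction-cross a b n eq = fromℚᵘ-cong {mkℚᵘ a 0} {mkℚᵘ b n} (*≡* (trans eq (sym (ℤP.*-identityʳ b))))

D-ratio : ∀ n j → D (suc n) (suc j) / 1 ≡ closedForm (suc n) (suc j) / suc n
D-ratio n j = fraction-cross (D (suc n) (suc j)) (closedForm (suc n) (suc j)) n (D-closedForm n j)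

-- The coefficients of a(1+y), for a sequence a vanishing from index K on:
-- [y^q] a(1+y) = Σ_{j<K} C(j,q) a_j.
at1+y : ℕ → (ℕ → ℤ) → ℕ → ℤ
at1+y K a q = Σ K (λ j → row j q * a j)

mul1+y : (ℕ → ℤ) → ℕ → ℤ
mul1+y a q = a q + shift a q

mul1+y-cong : ∀ {a b : ℕ → ℤ} → (∀ i → a i ≡ b i) → ∀ q → mul1+y a q ≡ mul1+y b q
mul1+y-cong eq q = cong₂ _+_ (eq q) (shift-cong eq q)

at1+y-shift : ∀ K (a : ℕ → ℤ) q → at1+y (suc K) (shift a) q ≡ mul1+y (at1+y K a) q
at1+y-shift K a q = begin
  row 0 q * + 0 + Σ K (λ j → row (suc j) q * a j)
    ≡⟨ cong (_+ Σ K (λ j → row (suc j) q * a j)) (ℤP.*-zeroʳ (row 0 q)) ⟩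
  + 0 + Σ K (λ j → row (suc j) q * a j)
    ≡⟨ ℤP.+-identityˡ _ ⟩
  Σ K (λ j → row (suc j) q * a j)
    ≡⟨ Σ-cong K (λ j _ → pascal-split j) ⟩
  Σ K (λ j → row j q * a j + shift (row j) q * a j)
    ≡⟨ Σ-+ K _ _ ⟩
  at1+y K a q + Σ K (λ j → shift (row j) q * a j)
    ≡⟨ cong (_+_ (at1+y K a q)) (Σ-shift K row a q) ⟩
  mul1+y (at1+y K a) q ∎
  where
    pascal-split : ∀ j → row (suc j) q * a j ≡ row j q * a j + shift (row j) q * a j
    pascal-split j = trans (cong (_* a j) (row-pascal j q)) (ℤP.*-distribʳ-+ (a j) (row j q) (shift (row j) q))

at1+y-pad : ∀ K (a : ℕ → ℤ) q → a K ≡ + 0 → at1+y (suc K) a q ≡ at1+y K a q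
at1+y-pad K a q aK≡0 =
  Σ-drop-last K (λ j → row j q * a j) (trans (cong (row K q *_) aK≡0) (ℤP.*-zeroʳ (row K q)))

at1+y-linear : ∀ K (a : ℕ → ℤ) q →
               at1+y K (mulQ a) q ≡ + 2 * at1+y K (shift a) q - at1+y K (shift (shift a)) q
at1+y-linear K a q = begin
  at1+y K (mulQ a) q
    ≡⟨ Σ-cong K (λ j _ → spread (row j q) (shift a j) (shift (shift a) j)) ⟩
  Σ K (λ j → + 2 * (row j q * shift a j) - row j q * shift (shift a) j)
    ≡⟨ Σ-− K (λ j → + 2 * (row j q * shift a j)) (λ j → row j q * shift (shift a) j) ⟩
  Σ K (λ j → + 2 * (row j q * shift a j)) - at1+y K (shift (shift a)) q
    ≡⟨ cong (_- at1+y K (shift (shift a)) q) (Σ-scale K (+ 2) (λ j → row j q * shift a j)) ⟩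
  + 2 * at1+y K (shift a) q - at1+y K (shift (shift a)) q ∎
  where
    spread : ∀ r a b → r * (+ 2 * a - b) ≡ + 2 * (r * a) - r * b
    spread = solve-∀

-- Q(1+y) = 2(1+y) - (1+y)² = 1 - y²: for a of degree < K,
-- (Q·a)(1+y) = a(1+y) - y² a(1+y).
at1+y-mulQ : ∀ K (a : ℕ → ℤ) q → a K ≡ + 0 →
             at1+y (suc (suc K)) (mulQ a) q ≡ at1+y K a q - shift (shift (at1+y K a)) q
at1+y-mulQ K a q aK≡0 = begin
  at1+y (suc (suc K)) (mulQ a) q
    ≡⟨ at1+y-linear (suc (suc K)) a q ⟩
  + 2 * at1+y (suc (suc K)) (shift a) q - at1+y (suc (suc K)) (shift (shift a)) q
    ≡⟨ cong₂ (λ x y → + 2 * x - y) (at1+y-shift (suc K) a q) (at1+y-shift (suc K) (shift a) q) ⟩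
  + 2 * mul1+y (at1+y (suc K) a) q - mul1+y (at1+y (suc K) (shift a)) q
    ≡⟨ cong₂ (λ x y → + 2 * x - y) (mul1+y-cong (λ i → at1+y-pad K a i aK≡0) q)
                                    (mul1+y-cong (at1+y-shift K a) q) ⟩
  + 2 * mul1+y S q - mul1+y (mul1+y S) q
    ≡⟨ cong (λ x → + 2 * mul1+y S q - (S q + shift S q + x)) (shift-pointwise _+_ refl S (shift S) q) ⟩
  + 2 * (S q + shift S q) - (S q + shift S q + (shift S q + shift (shift S) q))
    ≡⟨ cancel (S q) (shift S q) (shift (shift S) q) ⟩
  S q - shift (shift S) q ∎
  where
    S : ℕ → ℤ
    S = at1+y K a
    cancel : ∀ a b c → + 2 * (a + b) - (a + b + (b + c)) ≡ a - c
    cancel = solve-∀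

F-high : ∀ n j → 2 ℕ.* suc n ≤ j → F n j ≡ + 0
F-high n j 2n+2≤j = Σ-zero (suc n) _ (λ ℓ ℓ≤n →
  cong (_* row n ℓ) (oddPow-vanish ℓ j (ℕP.<-≤-trans (odd< ℓ≤n) 2n+2≤j)))
  where
    odd< : ∀ {ℓ} → ℓ < suc n → 2 ℕ.* ℓ ℕ.+ 1 < 2 ℕ.* suc n
    odd< {ℓ} ℓ<n+1 = ℕP.≤-trans (ℕP.≤-reflexive (twice ℓ)) (ℕP.*-monoʳ-≤ 2 ℓ<n+1)
      where
        twice : ∀ ℓ → suc (2 ℕ.* ℓ ℕ.+ 1) ≡ 2 ℕ.* suc ℓ
        twice = ℕSolver.solve-∀

-- S n = F n (1+y) = -y (1 - y²)^n.
S : ℕ → ℕ → ℤ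
S n = at1+y (2 ℕ.* suc n) (F n)

S-step : ∀ n q → S (suc n) q ≡ S n q - shift (shift (S n)) q
S-step n q = begin
  at1+y (2 ℕ.* suc (suc n)) (F (suc n)) q
    ≡⟨ cong (λ K → at1+y K (F (suc n)) q) (ℕP.*-suc 2 (suc n)) ⟩
  at1+y (suc (suc (2 ℕ.* suc n))) (F (suc n)) q
    ≡⟨ Σ-cong (suc (suc (2 ℕ.* suc n))) (λ j _ → cong (row j q *_) (F-step n j)) ⟩
  at1+y (suc (suc (2 ℕ.* suc n))) (mulQ (F n)) q
    ≡⟨ at1+y-mulQ (2 ℕ.* suc n) (F n) q (F-high n (2 ℕ.* suc n) ℕP.≤-refl) ⟩
  S n q - shift (shift (S n)) q ∎

double-suc : ∀ m → 2 ℕ.* suc m ≡ suc (suc (2 ℕ.* m))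
double-suc m = ℕP.*-suc 2 m

S-even : ∀ n m → S n (2 ℕ.* m) ≡ + 0
S-even zero    zero    = refl
S-even zero    (suc m) = cong (S 0) (double-suc m)
S-even (suc n) zero    = trans (S-step n 0) (trans (ℤP.+-identityʳ _) (S-even n 0))
S-even (suc n) (suc m) = begin
  S (suc n) (2 ℕ.* suc m)                      ≡⟨ cong (S (suc n)) (double-suc m) ⟩
  S (suc n) (suc (suc (2 ℕ.* m)))              ≡⟨ S-step n (suc (suc (2 ℕ.* m))) ⟩
  S n (suc (suc (2 ℕ.* m))) - S n (2 ℕ.* m)    ≡⟨ cong₂ _-_ (trans (cong (S n) (sym (double-suc m))) (S-even n (suc m)))
                                                          (S-even n m) ⟩
  + 0 - + 0                                    ∎

S-odd : ∀ n m → S n (suc (2 ℕ.* m)) ≡ - (row n m * sgn m)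
S-odd zero    zero    = refl
S-odd zero    (suc m) = cong (λ q → S 0 (suc q)) (double-suc m)
S-odd (suc n) zero    = trans (S-step n 1) (trans (ℤP.+-identityʳ _) (S-odd n 0))
S-odd (suc n) (suc m) = begin
  S (suc n) (suc (2 ℕ.* suc m))
    ≡⟨ cong (λ q → S (suc n) (suc q)) (double-suc m) ⟩
  S (suc n) (suc (suc (suc (2 ℕ.* m))))
    ≡⟨ S-step n (suc (suc (suc (2 ℕ.* m)))) ⟩
  S n (suc (suc (suc (2 ℕ.* m)))) - S n (suc (2 ℕ.* m))
    ≡⟨ cong₂ _-_ (trans (cong (λ q → S n (suc q)) (sym (double-suc m))) (S-odd n (suc m))) (S-odd n m) ⟩
  - (row n (suc m) * sgn (suc m)) - - (row n m * sgn m)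
    ≡⟨ cong (λ x → - (row n (suc m) * x) - - (row n m * sgn m)) (sgn-suc m) ⟩
  - (row n (suc m) * - sgn m) - - (row n m * sgn m)
    ≡⟨ combine (row n (suc m)) (row n m) (sgn m) ⟩
  - ((row n (suc m) + row n m) * - sgn m)
    ≡⟨ cong₂ (λ x y → - (x * y)) (row-pascal n (suc m)) (sgn-suc m) ⟨
  - (row (suc n) (suc m) * sgn (suc m)) ∎
  where
    combine : ∀ a b s → - (a * - s) - - (b * s) ≡ - ((a + b) * - s)
    combine = solve-∀

partII-sum : ℕ → ℕ → ℤ
partII-sum r p = sumFromTo p (2 ℕ.* r) (λ k → + ((k ∸ 1) C (k ∸ p)) * D r k)

partII-sum≡-4S : ∀ n q → partII-sum (suc n) (suc q) ≡ -4ℤ * S n q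
partII-sum≡-4S n q = begin
  sumFromTo q (n ℕ.+ suc (n ℕ.+ 0)) (λ j → + (j C (j ∸ q)) * D (suc n) (suc j))
    ≡⟨ sumFromTo-extend q (n ℕ.+ suc (n ℕ.+ 0)) term g agree vanish ⟩
  Σ (2 ℕ.* suc n) g
    ≡⟨ Σ-scale (2 ℕ.* suc n) -4ℤ (λ j → row j q * F n j) ⟩
  -4ℤ * S n q ∎
  where
    term g : ℕ → ℤ
    term j = + (j C (j ∸ q)) * D (suc n) (suc j)
    g j = -4ℤ * (row j q * F n j)
    -- C(j, j-q) = C(j, q) for j ≥ q
    agree : ∀ i → + ((q ℕ.+ i) C (q ℕ.+ i ∸ q)) * D (suc n) (suc (q ℕ.+ i)) ≡ g (q ℕ.+ i)
    agree i = begin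
      + ((q ℕ.+ i) C (q ℕ.+ i ∸ q)) * D (suc n) (suc (q ℕ.+ i))
        ≡⟨ cong (λ c → + c * D (suc n) (suc (q ℕ.+ i))) (nCk≡nC[n∸k] (ℕP.m≤m+n q i)) ⟨
      row (q ℕ.+ i) q * D (suc n) (suc (q ℕ.+ i))
        ≡⟨ cong (row (q ℕ.+ i) q *_) (D≡-4F n (q ℕ.+ i)) ⟩
      row (q ℕ.+ i) q * (-4ℤ * F n (q ℕ.+ i))
        ≡⟨ swap (row (q ℕ.+ i) q) (F n (q ℕ.+ i)) ⟩
      g (q ℕ.+ i) ∎
      where
        swap : ∀ b f → b * (- + 4 * f) ≡ - + 4 * (b * f)
        swap = solve-∀
    vanish : ∀ j → j < q → g j ≡ + 0
    vanish j j<q = cong (λ x → -4ℤ * (x * F n j)) (row-vanish j<q)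

partII-odd : ∀ n q m → suc q ≡ 1 ℕ.+ 2 ℕ.* m → partII-sum (suc n) (suc q) ≡ + 0
partII-odd n q m p≡2m+1 = begin
  partII-sum (suc n) (suc q)   ≡⟨ partII-sum≡-4S n q ⟩
  -4ℤ * S n q                  ≡⟨ cong (λ q → -4ℤ * S n q) (ℕP.suc-injective p≡2m+1) ⟩
  -4ℤ * S n (2 ℕ.* m)          ≡⟨ cong (-4ℤ *_) (S-even n m) ⟩
  + 0                          ∎

partII-even : ∀ n q m → suc q ≡ 2 ℕ.* suc m → partII-sum (suc n) (suc q) ≡ + 4 * row n m * sgn m
partII-even n q m p≡2m+2 = begin
  partII-sum (suc n) (suc q)   ≡⟨ partII-sum≡-4S n q ⟩
  -4ℤ * S n q                  ≡⟨ cong (λ q → -4ℤ * S n q) (ℕP.suc-injective (trans p≡2m+2 (double-suc m))) ⟩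
  -4ℤ * S n (suc (2 ℕ.* m))    ≡⟨ cong (-4ℤ *_) (S-odd n m) ⟩
  -4ℤ * - (row n m * sgn m)    ≡⟨ negate (row n m) (sgn m) ⟩
  + 4 * row n m * sgn m        ∎
  where
    negate : ∀ b s → - + 4 * - (b * s) ≡ + 4 * b * s
    negate = solve-∀

lemma3p8 : (r : ℕ) → .{{_ : NonZero r}} →
    ((k : ℕ) → 1 ≤ k → k ≤ 2 ℕ.* r →
      ((D r k / 1)
        ≡ ((choose r (+ k ℤ.- + r) ℤ.* + (2 ℕ.* k) ℤ.* sgn (k ℕ.+ r ∸ 1) ℤ.* + (2 ℕ.^ (2 ℕ.* r ∸ k))) / r))
      × (k ≤ r ∸ 1 → D r k ≡ + 0))
    × ((p : ℕ) → 1 ≤ p → p ≤ 2 ℕ.* r →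
      ((m : ℕ) → p ≡ 1 ℕ.+ 2 ℕ.* m →
        sumFromTo p (2 ℕ.* r) (λ k → + ((k ∸ 1) C (k ∸ p)) ℤ.* D r k) ≡ + 0)
      × ((m : ℕ) → p ≡ 2 ℕ.* m →
        sumFromTo p (2 ℕ.* r) (λ k → + ((k ∸ 1) C (k ∸ p)) ℤ.* D r k)
          ≡ + 4 ℤ.* + ((r ∸ 1) C (m ∸ 1)) ℤ.* sgn (m ∸ 1)))
lemma3p8 (suc n) =
    (λ { (suc j) _ _ → D-ratio n j , D-below n j })
  , (λ { (suc q) _ _ → partII-odd n q , λ { zero () ; (suc m) → partII-even n q m } })
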